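{- Let $K$ be an algebraically closed field, let $X\subset\mathbb{P}^n$ be a smooth cubic hypersurface over $K$ with $n\geq4$, and let $x\in X$ be an Eckardt point of $X$. If $H\subset\mathbb{P}^n$ is a hyperplane containing $x$ such that $X\cap H$ is smooth, then $x$ is an Eckardt point of the cubic hypersurface $X\cap H\subset H\cong\mathbb{P}^{n-1}$.
   Context: For a smooth cubic hypersurface $Y\subset\mathbb{P}^m$ with $m\geq3$, a point $y\in Y$ is an Eckardt point if $Y\cap T_yY$ is a cone with vertex $y$, where $T_yY\subset\mathbb{P}^m$ is the embedded tangent space of $Y$ at $y$. The field $K$ may have any characteristic. -}

module Defs where

open import Level using (Level; _⊔_)
open import Data.Nat using (ℕ; zero; suc)
open import Data.Fin using (Fin; zero; suc; _≟_; toℕ)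
open import Data.Product using (Σ; ∃; _×_; _,_)
open import Relation.Nullary using (¬_; yes; no)
open import Algebra.Bundles using (CommutativeRing)

-- Everything is phrased over a commutative ring R (with setoid equality ≈);
-- the field / algebraic-closedness hypotheses are separate predicates.
module Geometry {c ℓ : Level} (R : CommutativeRing c ℓ) where
  open CommutativeRing R using (Carrier; _≈_; _+_; _*_; 0#; 1#)

  sumF : (N : ℕ) → (Fin N → Carrier) → Carrier
  sumF zero    f = 0#
  sumF (suc N) f = f zero + sumF N (λ i → f (suc i))

  pow : Carrier → ℕ → Carrier
  pow x zero    = 1#
  pow x (suc k) = x * pow x k

  IsField : Set (c ⊔ ℓ)
  IsField = (¬ (0# ≈ 1#)) × (∀ x → ¬ (x ≈ 0#) → ∃ λ y → x * y ≈ 1#)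

  AlgClosed : Set (c ⊔ ℓ)
  AlgClosed = ∀ (d : ℕ) (a : Fin (suc d) → Carrier) →
    ∃ λ t → pow t (suc d) + sumF (suc d) (λ i → a i * pow t (toℕ i)) ≈ 0#

  -- vectors in K^N (homogeneous coordinates on P^(N-1))
  Vect : ℕ → Set c
  Vect N = Fin N → Carrier

  NonZero : {N : ℕ} → Vect N → Set ℓ
  NonZero {N} v = ¬ (∀ i → v i ≈ 0#)

  axpy : {N : ℕ} → Carrier → Vect N → Vect N → Vect N
  axpy s y w i = s * y i + w i

  -- a cubic form in N variables, given by coefficients:
  -- F(v) = Σ_{i,j,k} c_{ijk} v_i v_j v_k   (every cubic form arises this way)
  Cubic : ℕ → Set c
  Cubic N = Fin N → Fin N → Fin N → Carrier

  eval : {N : ℕ} → Cubic N → Vect N → Carrier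
  eval {N} F v = sumF N λ i → sumF N λ j → sumF N λ k →
    F i j k * (v i * (v j * v k))

  δ : {N : ℕ} → Fin N → Fin N → Carrier
  δ i l with i ≟ l
  ... | yes _ = 1#
  ... | no  _ = 0#

  partial : {N : ℕ} → Cubic N → Fin N → Vect N → Carrier
  partial {N} F l v = sumF N λ i → sumF N λ j → sumF N λ k →
    F i j k * (δ i l * (v j * v k) + (δ j l * (v i * v k) + δ k l * (v i * v j)))

  dF : {N : ℕ} → Cubic N → Vect N → Vect N → Carrier
  dF {N} F v w = sumF N λ l → partial F l v * w l

  lin : {N : ℕ} → Vect N → Vect N → Carrier
  lin {N} h v = sumF N λ i → h i * v i

  -- A projective subspace P(W) ⊆ P^(N-1) is described by a predicate W on K^N
  -- (the linear subspace W).  We use W = everything (the ambient P^(N-1))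
  -- and W = a hyperplane.  The hypersurface is Y = V(F) ∩ P(W) ⊆ P(W).
  Everything : {N : ℕ} → Vect N → Set ℓ
  Everything _ = 0# ≈ 0#

  InHyperplane : {N : ℕ} → Vect N → Vect N → Set ℓ
  InHyperplane h v = lin h v ≈ 0#

  -- Y = V(F) ∩ P(W) is smooth (Jacobian criterion on P(W)): there is no nonzero
  -- z ∈ W with F(z) = 0 and dF_z vanishing on W.
  Smooth : {N : ℕ} → (Vect N → Set ℓ) → Cubic N → Set (c ⊔ ℓ)
  Smooth {N} W F = ∀ (z : Vect N) → W z → NonZero z → eval F z ≈ 0# →
    ¬ (∀ w → W w → dF F z w ≈ 0#)

  OnY : {N : ℕ} → (Vect N → Set ℓ) → Cubic N → Vect N → Set ℓ
  OnY W F y = W y × NonZero y × (eval F y ≈ 0#)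

  Tangent : {N : ℕ} → (Vect N → Set ℓ) → Cubic N → Vect N → Vect N → Set ℓ
  Tangent W F y w = W w × (dF F y w ≈ 0#)

  -- y is an Eckardt point of Y: Y ∩ T_yY is a cone with vertex y, i.e. the
  -- cubic form F restricted to T_yY is invariant under translation by y:
  -- F(s·y + w) = F(w) for all w ∈ T_yY and all scalars s.
  Eckardt : {N : ℕ} → (Vect N → Set ℓ) → Cubic N → Vect N → Set (c ⊔ ℓ)
  Eckardt W F y = OnY W F y ×
    (∀ w → Tangent W F y w → ∀ s → eval F (axpy s y w) ≈ eval F w)

{-# OPTIONS --safe #-}
module Submission where

open import Defs
open import Level using (Level)
open import Data.Nat using (ℕ; suc; _≤_)
open import Algebra.Bundles using (CommutativeRing)
open import Data.Product using (_,_)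
open import Relation.Unary using (_⊆′_)

-- The cone condition only involves the tangent space T_yY = W ∩ {dF_y = 0},
-- which shrinks when W does; so a cone over y stays a cone after cutting
-- with any linear subspace through y.

module _ {c ℓ : Level} (R : CommutativeRing c ℓ) where
  open Geometry R

  Tangent-mono : ∀ {N} {W W′ : Vect N → Set ℓ} (F : Cubic N) (y : Vect N) →
    W′ ⊆′ W → Tangent W′ F y ⊆′ Tangent W F y
  Tangent-mono F y W′⊆W w (w∈W′ , dFw≈0) = W′⊆W w w∈W′ , dFw≈0

  Eckardt-restrict : ∀ {N} {W W′ : Vect N → Set ℓ} (F : Cubic N) (y : Vect N) →
    W′ ⊆′ W → W′ y →
    Eckardt W F y → Eckardt W′ F y
  Eckardt-restrict F y W′⊆W y∈W′ ((_ , y≢0 , Fy≈0) , cone) =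
    (y∈W′ , y≢0 , Fy≈0) ,
    λ w w∈T s → cone w (Tangent-mono F y W′⊆W w w∈T) s

lemma4p6 : ∀ {c ℓ : Level} (K : CommutativeRing c ℓ) →
    Geometry.IsField K → Geometry.AlgClosed K →
    ∀ (n : ℕ) → 4 ≤ n →
    (F : Geometry.Cubic K (suc n)) →
    Geometry.Smooth K (Geometry.Everything K) F →
    (x : Geometry.Vect K (suc n)) →
    Geometry.Eckardt K (Geometry.Everything K) F x →
    (h : Geometry.Vect K (suc n)) → Geometry.NonZero K h →
    Geometry.InHyperplane K h x →
    Geometry.Smooth K (Geometry.InHyperplane K h) F →
    Geometry.Eckardt K (Geometry.InHyperplane K h) F x
lemma4p6 K _ _ n _ F _ x x-Eckardt h _ x∈H _ =
  Eckardt-restrict K F x (λ _ _ → CommutativeRing.refl K) x∈H x-Eckardt
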